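{- Let $\lambda,\mu$ be partitions with at most $\ell$ parts (padded with zeros), and let $\mathbf{s}=(s_1,\dots,s_\ell)$ be positive integers such that $s_i\le s_{i+1}$ whenever $\mu_i<\lambda_{i+1}$, $1\le i\le\ell-1$. Then \[ G^{\mathrm{row}(\mathbf{1},\mathbf{s})}_{\lambda/\mu}(\mathbf{x};\boldsymbol\alpha,\boldsymbol\beta)=\det\Bigl[\sum_{m=0}^\infty h_m(A_{(\mu_j,\lambda_i]}+B_{(i,j]})\,\mathfrak{G}^{[s_i/1]}_{\lambda_i-\mu_j-i+j+m}(\mathbf{x},\beta_i)\Bigr]_{i,j=1}^{\ell}. \]
   Context: Alphabets: an alphabet is a formal $\mathbb{Z}$-linear combination $Z=\sum_ic_iz_i$ of variables, with sum/difference $X\pm Y$; $h_m(Z)$ is defined by $\sum_{m\ge0}h_m(Z)t^m=\prod_i(1-z_it)^{ -c_i}$, $h_m=0$ for $m<0$. For variables $\mathbf{x}=(x_1,x_2,\dots)$ let $\mathbf{x}_{[r,s]}=x_r+\dots+x_s$, and $h_m(\mathbf{x}_{[r,s]}\ominus Y)=\sum_{a,b\ge0,\,a-b=m}h_a(\mathbf{x}_{[r,s]})h_b(Y)$ for $m\in\mathbb{Z}$. $A_k=(-\alpha_1)+\dots+(-\alpha_k)$, $B_k=\beta_1+\dots+\beta_k$ ($k\ge1$), $A_k=B_k=0$ ($k\le0$); for integers $i,j$, $A_{[i,j]}=A_j-A_{i-1}$, $A_{(i,j]}=A_{[i+1,j]}$, likewise for $B$. Flagged canonical Grothendieck (row flags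 $r_i=1$): $G^{\mathrm{row}(\mathbf{1},\mathbf{s})}_{\lambda/\mu}(\mathbf{x};\boldsymbol\alpha,\boldsymbol\beta)=\prod_{i=1}^\ell\prod_{k=1}^{s_i}(1-\beta_ix_k)\det\bigl[h_{\lambda_i-\mu_j-i+j}(\mathbf{x}_{[1,s_i]}\ominus(A_{(\mu_j,\lambda_i]}+B_{[i,j]}))\bigr]_{i,j=1}^\ell$. Flagged $\beta$-Grothendieck polynomial: $\mathfrak{G}^{[s/r]}_k(\mathbf{x},\beta)$ ($k\in\mathbb{Z}$) is the coefficient of $z^k$ in $\bigl(\sum_{a\ge0}\beta^az^{ -a}\bigr)\prod_{k=r}^{s}\frac{1-\beta x_k}{1-x_kz}$ (the factor $(1-\beta z^{ -1})^{ -1}$ expanded in powers of $z^{ -1}$). -}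

module Defs where

open import Data.Bool using (Bool; true; false; _∧_; if_then_else_)
open import Data.Nat as ℕ using (ℕ; zero; suc; _∸_; _≡ᵇ_)
open import Data.Integer as ℤ using (ℤ; +_; -[1+_])
open import Data.List using (List; []; _∷_; map; foldr; upTo; concat; _++_; allFin)
open import Data.Fin using (Fin; toℕ; punchIn) renaming (zero to fzero; suc to fsuc)
open import Data.Product using (_×_; _,_; proj₁; proj₂)
open import Relation.Binary.PropositionalEquality using (_≡_)

-- Formal power series over ℤ in countably many variables v₀, v₁, …
-- A monomial is an exponent list (entry j = exponent of v_j; missing
-- trailing entries are 0).

Mono : Set
Mono = List ℕ

PS : Set
PS = Mono → ℤ

_≈ₚ_ : PS → PS → Set
p ≈ₚ q = ∀ (e : Mono) → p e ≡ q e

allZero : Mono → Bool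
allZero []      = true
allZero (k ∷ e) = (k ≡ᵇ 0) ∧ allZero e

deg : Mono → ℕ
deg = foldr ℕ._+_ 0

sumℤ : List ℤ → ℤ
sumℤ = foldr ℤ._+_ (+ 0)

0ₚ : PS
0ₚ _ = + 0

1ₚ : PS
1ₚ e = if allZero e then + 1 else + 0

_+ₚ_ : PS → PS → PS
(p +ₚ q) e = p e ℤ.+ q e

-ₚ_ : PS → PS
(-ₚ p) e = ℤ.- p e

_-ₚ_ : PS → PS → PS
p -ₚ q = p +ₚ (-ₚ q)

splits : Mono → List (Mono × Mono)
splits []      = ([] , []) ∷ []
splits (k ∷ e) =
  concat (map (λ i → map (λ pr → (i ∷ proj₁ pr) , ((k ∸ i) ∷ proj₂ pr)) (splits e))
              (upTo (suc k)))

_*ₚ_ : PS → PS → PS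
(p *ₚ q) e = sumℤ (map (λ pr → p (proj₁ pr) ℤ.* q (proj₂ pr)) (splits e))

infixl 6 _+ₚ_ _-ₚ_
infixl 7 _*ₚ_

_^ₚ_ : PS → ℕ → PS
p ^ₚ zero  = 1ₚ
p ^ₚ suc n = p *ₚ (p ^ₚ n)

sumₚ : List PS → PS
sumₚ = foldr _+ₚ_ 0ₚ

prodₚ : List PS → PS
prodₚ = foldr _*ₚ_ 1ₚ

isUnitAt : ℕ → Mono → Bool
isUnitAt j       []      = false
isUnitAt zero    (k ∷ e) = (k ≡ᵇ 1) ∧ allZero e
isUnitAt (suc j) (k ∷ e) = (k ≡ᵇ 0) ∧ isUnitAt j e

var : ℕ → PS
var j e = if isUnitAt j e then + 1 else + 0

-- Infinite sum Σ_{n ≥ 0} f n, for families in which every monomial of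
-- f n has total degree ≥ n (the only families it is applied to below);
-- for such families the sum converges formally and its coefficient at e
-- only involves n ≤ deg e.
Σ∞ : (ℕ → PS) → PS
Σ∞ f e = sumℤ (map (λ n → f n e) (upTo (suc (deg e))))

𝕩 : ℕ → PS
𝕩 k = var (3 ℕ.* k)

𝛂 : ℕ → PS
𝛂 k = var (suc (3 ℕ.* k))

𝛃 : ℕ → PS
𝛃 k = var (suc (suc (3 ℕ.* k)))

-- [r, s] = r, r+1, …, s   (empty if s < r)
range : ℕ → ℕ → List ℕ
range r s = map (r ℕ.+_) (upTo (suc s ∸ r))

-- Alphabets: formal ℤ-linear combinations of letters, represented as a
-- list of signed letters (a letter with coefficient c occurs |c| times
-- with the sign of c; cancellations need not be performed since h_m
-- only depends on the formal combination).

data Sign : Set where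
  pos neg : Sign

flip : Sign → Sign
flip pos = neg
flip neg = pos

Alphabet : Set
Alphabet = List (Sign × PS)

negA : Alphabet → Alphabet
negA = map (λ p → flip (proj₁ p) , proj₂ p)

-- h_m(Z):  Σ_m h_m(Z) t^m = Π_i (1 - z_i t)^{-c_i}
h : ℕ → Alphabet → PS
h zero    []              = 1ₚ
h (suc m) []              = 0ₚ
h m       ((pos , z) ∷ Z) = sumₚ (map (λ a → (z ^ₚ a) *ₚ h (m ∸ a) Z) (upTo (suc m)))
h zero    ((neg , z) ∷ Z) = h zero Z
h (suc m) ((neg , z) ∷ Z) = h (suc m) Z -ₚ z *ₚ h m Z

hℤ : ℤ → Alphabet → PS
hℤ (+ m)    Z = h m Z
hℤ -[1+ _ ] Z = 0ₚ

h⊖ : ℤ → Alphabet → Alphabet → PS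
h⊖ m X Y = Σ∞ (λ b → hℤ (m ℤ.+ + b) X *ₚ h b Y)

xA : ℕ → ℕ → Alphabet
xA r s = map (λ k → pos , 𝕩 k) (range r s)

Aₖ : ℕ → Alphabet
Aₖ k = map (λ t → pos , (-ₚ 𝛂 t)) (range 1 k)

Bₖ : ℕ → Alphabet
Bₖ k = map (λ t → pos , 𝛃 t) (range 1 k)

A⟨_,_] : ℕ → ℕ → Alphabet
A⟨ a , b ] = Aₖ b ++ negA (Aₖ a)

B[_,_] : ℕ → ℕ → Alphabet
B[ i , j ] = Bₖ j ++ negA (Bₖ (i ∸ 1))

B⟨_,_] : ℕ → ℕ → Alphabet
B⟨ i , j ] = Bₖ j ++ negA (Bₖ i)

det : ∀ {n} → (Fin n → Fin n → PS) → PS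
det {zero}  M = 1ₚ
det {suc n} M = sumₚ (map (λ j → ((-ₚ 1ₚ) ^ₚ toℕ j) *ₚ M fzero j
                                 *ₚ det (λ i k → M (fsuc i) (punchIn j k)))
                          (allFin (suc n)))

-- Series in an auxiliary variable z with only nonnegative powers:
-- coefficient function n ↦ [z^n].

ZS : Set
ZS = ℕ → PS

_⋆_ : ZS → ZS → ZS
(f ⋆ g) n = sumₚ (map (λ a → f a *ₚ g (n ∸ a)) (upTo (suc n)))

constZ : PS → ZS
constZ c zero    = c
constZ c (suc _) = 0ₚ

1Z : ZS
1Z = constZ 1ₚ

-- 1/(1 - x z) = Σ_n x^n z^n
geomZ : PS → ZS
geomZ x n = x ^ₚ n

coeffZ : ZS → ℤ → PS
coeffZ f (+ n)    = f n
coeffZ f -[1+ _ ] = 0ₚ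

-- Flagged β-Grothendieck polynomial 𝔊^{[s/r]}_k(x, β):
-- the coefficient of z^k in (Σ_{a≥0} β^a z^{-a}) Π_{t=r}^{s} (1 - β x_t)/(1 - x_t z),
-- i.e. Σ_{a ≥ 0} β^a [z^{k+a}] Π_{t=r}^{s} (1 - β x_t)/(1 - x_t z).
𝔊 : ℕ → ℕ → ℤ → PS → PS
𝔊 s r k β = Σ∞ (λ a → (β ^ₚ a) *ₚ coeffZ P (k ℤ.+ + a))
  where
  P : ZS
  P = foldr (λ t acc → (constZ (1ₚ -ₚ β *ₚ 𝕩 t) ⋆ geomZ (𝕩 t)) ⋆ acc) 1Z (range r s)

-- Partitions of length ℓ (padded with zeros), indexed by Fin ℓ
-- (index i : Fin ℓ stands for the paper's index toℕ i + 1).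

IsPartition : ∀ {ℓ} → (Fin ℓ → ℕ) → Set
IsPartition {ℓ} la = ∀ (i j : Fin ℓ) → toℕ i ℕ.≤ toℕ j → la j ℕ.≤ la i

ix : ∀ {ℓ} → Fin ℓ → ℕ
ix i = suc (toℕ i)

shift : ℕ → ℕ → ℕ → ℕ → ℤ
shift li mj i j = + li ℤ.- + mj ℤ.- + i ℤ.+ + j

Grow : (ℓ : ℕ) → (la mu s : Fin ℓ → ℕ) → PS
Grow ℓ la mu s =
  prodₚ (map (λ i → prodₚ (map (λ k → 1ₚ -ₚ 𝛃 (ix i) *ₚ 𝕩 k) (range 1 (s i))))
             (allFin ℓ))
  *ₚ det (λ i j → h⊖ (shift (la i) (mu j) (ix i) (ix j))
                     (xA 1 (s i))
                     (A⟨ mu j , la i ] ++ B[ ix i , ix j ]))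

RHS : (ℓ : ℕ) → (la mu s : Fin ℓ → ℕ) → PS
RHS ℓ la mu s =
  det (λ i j → Σ∞ (λ m → h m (A⟨ mu j , la i ] ++ B⟨ ix i , ix j ])
                          *ₚ 𝔊 (s i) 1 (shift (la i) (mu j) (ix i) (ix j) ℤ.+ + m) (𝛃 (ix i))))

-- Multiply row i of the left-hand matrix by Π_{k ≤ s_i} (1 - β_i x_k); the rows of the
-- right-hand matrix then agree with it entry by entry, so the hypotheses on λ, μ and s
-- are not needed.  For one entry, write Y = A_{(μ_j,λ_i]} + B_{[i,j]}, so that
-- B_{(i,j]} = B_{[i,j]} - β_i turns the right-hand alphabet into Y - β_i.  Removing a
-- letter gives h_b(Y) = Σ_m h_m(Y - β) β^{b-m}; substituting this into
-- h_k(X ⊖ Y) = Σ_b h_{k+b}(X) h_b(Y) and reordering the double sum (formally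
-- convergent, since every term of index n has order ≥ n) gives
-- Σ_m h_m(Y - β) Σ_a β^a h_{k+m+a}(X).  Finally Π_t (1 - β x_t) h_n(X) is the
-- coefficient of z^n in Π_t (1 - β x_t)/(1 - x_t z), which turns the inner sum into
-- 𝔊_{k+m}.  Formal power series are shown to form a commutative ring by splitting off
-- the exponent of the first variable, which reduces products to convolutions.

module Submission where

open import Defs
open import Algebra.Bundles using (CommutativeRing)
import Algebra.Structures
import Data.Integer.Properties as ℤP
import Data.List.Properties as ListP
open import Data.Product using (_×_; _,_)
open import Data.Nat as ℕ using (ℕ; zero; suc; _≤_; _<_; s≤s; z<s; s<s; _∸_)
import Data.Nat.Properties as ℕP
open import Data.List using (List; []; _∷_; map; foldr; applyUpTo; upTo; concat; _++_; allFin; tabulate)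
open import Data.Fin using (Fin; toℕ; punchIn) renaming (zero to fzero; suc to fsuc)
open import Data.List.Relation.Unary.All as All using (All; []; _∷_)
open import Data.List.Relation.Unary.All.Properties using (concat⁺; map⁺; applyUpTo⁺₁; ++⁺)
open import Data.Bool using (false)
open import Relation.Nullary using (yes; no)
open import Relation.Nullary.Negation using (contradiction)
open import Function using (_∘_; id)
import Relation.Binary.PropositionalEquality as Eq
open Eq using (_≡_)

-- Finite sums and convolution of sequences

module FiniteSums {c ℓ} (R : CommutativeRing c ℓ) where

  open CommutativeRing R
  open import Relation.Binary.Reasoning.Setoid setoid
  open import Algebra.Properties.CommutativeSemigroup +-commutativeSemigroup using (interchange)

  ∑< : ℕ → (ℕ → Carrier) → Carrier
  ∑< zero    f = 0#
  ∑< (suc n) f = f 0 + ∑< n (f ∘ suc)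

  syntax ∑< n (λ i → x) = ∑[ i < n ] x

  ∑-cong< : ∀ n {f g} → (∀ i → i < n → f i ≈ g i) → ∑< n f ≈ ∑< n g
  ∑-cong< zero    f≈g = refl
  ∑-cong< (suc n) f≈g = +-cong (f≈g 0 z<s) (∑-cong< n (λ i i<n → f≈g (suc i) (s<s i<n)))

  ∑-cong : ∀ n {f g} → (∀ i → f i ≈ g i) → ∑< n f ≈ ∑< n g
  ∑-cong n f≈g = ∑-cong< n (λ i _ → f≈g i)

  ∑-zero : ∀ n {f} → (∀ i → i < n → f i ≈ 0#) → ∑< n f ≈ 0#
  ∑-zero n f≈0 = trans (∑-cong< n f≈0) (zeros n)
    where
    zeros : ∀ n → ∑< n (λ _ → 0#) ≈ 0#
    zeros zero    = refl
    zeros (suc n) = trans (+-identityˡ _) (zeros n)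

  ∑-distrib-+ : ∀ n f g → ∑[ i < n ] (f i + g i) ≈ ∑< n f + ∑< n g
  ∑-distrib-+ zero    f g = sym (+-identityˡ 0#)
  ∑-distrib-+ (suc n) f g = trans (+-congˡ (∑-distrib-+ n (f ∘ suc) (g ∘ suc))) (interchange _ _ _ _)

  *-distribˡ-∑ : ∀ a n f → a * ∑< n f ≈ ∑[ i < n ] (a * f i)
  *-distribˡ-∑ a zero    f = zeroʳ a
  *-distribˡ-∑ a (suc n) f = trans (distribˡ a _ _) (+-congˡ (*-distribˡ-∑ a n (f ∘ suc)))

  *-distribʳ-∑ : ∀ a n f → ∑< n f * a ≈ ∑[ i < n ] (f i * a)
  *-distribʳ-∑ a zero    f = zeroˡ a
  *-distribʳ-∑ a (suc n) f = trans (distribʳ a _ _) (+-congˡ (*-distribʳ-∑ a n (f ∘ suc)))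

  ∑-last : ∀ n f → ∑< (suc n) f ≈ ∑< n f + f n
  ∑-last zero    f = +-comm _ _
  ∑-last (suc n) f = trans (+-congˡ (∑-last n (f ∘ suc))) (sym (+-assoc _ _ _))

  ∑-reverse : ∀ k f → ∑< (suc k) f ≈ ∑[ i < suc k ] f (k ∸ i)
  ∑-reverse zero    f = refl
  ∑-reverse (suc k) f = begin
      f 0 + ∑< (suc k) (f ∘ suc)
    ≈⟨ +-congˡ (∑-reverse k (f ∘ suc)) ⟩
      f 0 + ∑[ i < suc k ] f (suc (k ∸ i))
    ≈⟨ +-comm _ _ ⟩
      ∑[ i < suc k ] f (suc (k ∸ i)) + f 0
    ≈⟨ +-cong (∑-cong< (suc k) (λ { i (s≤s i≤k) → reflexive (Eq.cong f (Eq.sym (ℕP.+-∸-assoc 1 i≤k))) }))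
              (reflexive (Eq.cong f (Eq.sym (ℕP.n∸n≡0 (suc k))))) ⟩
      ∑[ i < suc k ] f (suc k ∸ i) + f (suc k ∸ suc k)
    ≈⟨ sym (∑-last (suc k) (λ i → f (suc k ∸ i))) ⟩
      ∑[ i < suc (suc k) ] f (suc k ∸ i)
    ∎

  ∑-padʳ : ∀ n d f → (∀ i → n ≤ i → i < n ℕ.+ d → f i ≈ 0#) → ∑< (n ℕ.+ d) f ≈ ∑< n f
  ∑-padʳ n zero    f f≈0 rewrite ℕP.+-identityʳ n = refl
  ∑-padʳ n (suc d) f f≈0 rewrite ℕP.+-suc n d = begin
      ∑< (suc (n ℕ.+ d)) f
    ≈⟨ ∑-last (n ℕ.+ d) f ⟩
      ∑< (n ℕ.+ d) f + f (n ℕ.+ d)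
    ≈⟨ +-cong (∑-padʳ n d f (λ i n≤i i<n+d → f≈0 i n≤i (ℕP.m<n⇒m<1+n i<n+d)))
              (f≈0 (n ℕ.+ d) (ℕP.m≤m+n n d) (ℕP.n<1+n _)) ⟩
      ∑< n f + 0#
    ≈⟨ +-identityʳ _ ⟩
      ∑< n f
    ∎

  ∑-antidiagonal : ∀ (F : ℕ → ℕ → Carrier) k →
    ∑[ i < suc k ] ∑[ j < suc i ] F j (i ∸ j) ≈ ∑[ j < suc k ] ∑< (suc (k ∸ j)) (F j)
  ∑-antidiagonal F zero    = refl
  ∑-antidiagonal F (suc k) = begin
      ∑< (suc (suc k)) D
    ≈⟨ ∑-last (suc k) D ⟩
      ∑< (suc k) D + D (suc k)
    ≈⟨ +-cong (∑-antidiagonal F k) (∑-last (suc k) (λ j → F j (suc k ∸ j))) ⟩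
      ∑[ j < suc k ] ∑< (suc (k ∸ j)) (F j) + (∑[ j < suc k ] F j (suc k ∸ j) + F (suc k) (suc k ∸ suc k))
    ≈⟨ sym (+-assoc _ _ _) ⟩
      (∑[ j < suc k ] ∑< (suc (k ∸ j)) (F j) + ∑[ j < suc k ] F j (suc k ∸ j)) + F (suc k) (suc k ∸ suc k)
    ≈⟨ +-cong (sym (∑-distrib-+ (suc k) (λ j → ∑< (suc (k ∸ j)) (F j)) (λ j → F j (suc k ∸ j))))
              (reflexive (Eq.cong (F (suc k)) (ℕP.n∸n≡0 k))) ⟩
      ∑[ j < suc k ] (∑< (suc (k ∸ j)) (F j) + F j (suc k ∸ j)) + F (suc k) 0
    ≈⟨ +-cong (∑-cong< (suc k) (λ { j (s≤s j≤k) → extend j j≤k })) (sym (+-identityʳ _)) ⟩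
      ∑[ j < suc k ] ∑< (suc (suc k ∸ j)) (F j) + ∑< 1 (F (suc k))
    ≈⟨ +-congˡ (reflexive (Eq.cong (λ d → ∑< (suc d) (F (suc k))) (Eq.sym (ℕP.n∸n≡0 k)))) ⟩
      ∑[ j < suc k ] ∑< (suc (suc k ∸ j)) (F j) + ∑< (suc (suc k ∸ suc k)) (F (suc k))
    ≈⟨ sym (∑-last (suc k) (λ j → ∑< (suc (suc k ∸ j)) (F j))) ⟩
      ∑[ j < suc (suc k) ] ∑< (suc (suc k ∸ j)) (F j)
    ∎
    where
    D : ℕ → Carrier
    D i = ∑[ j < suc i ] F j (i ∸ j)
    extend : ∀ j → j ≤ k → ∑< (suc (k ∸ j)) (F j) + F j (suc k ∸ j) ≈ ∑< (suc (suc k ∸ j)) (F j)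
    extend j j≤k rewrite ℕP.+-∸-assoc 1 j≤k = sym (∑-last (suc (k ∸ j)) (F j))

  ∑ₗ : ∀ {a} {A : Set a} → List A → (A → Carrier) → Carrier
  ∑ₗ xs f = foldr _+_ 0# (map f xs)

  ∑ₗ-congᴬ : ∀ {a} {A : Set a} {f g : A → Carrier} xs → All (λ x → f x ≈ g x) xs → ∑ₗ xs f ≈ ∑ₗ xs g
  ∑ₗ-congᴬ []       []           = refl
  ∑ₗ-congᴬ (x ∷ xs) (fx≈gx ∷ eqs) = +-cong fx≈gx (∑ₗ-congᴬ xs eqs)

  ∑ₗ-cong : ∀ {a} {A : Set a} {f g : A → Carrier} xs → (∀ x → f x ≈ g x) → ∑ₗ xs f ≈ ∑ₗ xs g
  ∑ₗ-cong []       f≈g = refl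
  ∑ₗ-cong (x ∷ xs) f≈g = +-cong (f≈g x) (∑ₗ-cong xs f≈g)

  ∑ₗ-zeroᴬ : ∀ {a} {A : Set a} {f : A → Carrier} xs → All (λ x → f x ≈ 0#) xs → ∑ₗ xs f ≈ 0#
  ∑ₗ-zeroᴬ []       []          = refl
  ∑ₗ-zeroᴬ (x ∷ xs) (fx≈0 ∷ eqs) = trans (+-cong fx≈0 (∑ₗ-zeroᴬ xs eqs)) (+-identityˡ 0#)

  ∑ₗ-zero : ∀ {a} {A : Set a} {f : A → Carrier} xs → (∀ x → f x ≈ 0#) → ∑ₗ xs f ≈ 0#
  ∑ₗ-zero []       f≈0 = refl
  ∑ₗ-zero (x ∷ xs) f≈0 = trans (+-cong (f≈0 x) (∑ₗ-zero xs f≈0)) (+-identityˡ 0#)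

  ∑ₗ-distrib-+ : ∀ {a} {A : Set a} (f g : A → Carrier) xs → ∑ₗ xs (λ x → f x + g x) ≈ ∑ₗ xs f + ∑ₗ xs g
  ∑ₗ-distrib-+ f g []       = sym (+-identityˡ 0#)
  ∑ₗ-distrib-+ f g (x ∷ xs) = trans (+-congˡ (∑ₗ-distrib-+ f g xs)) (interchange _ _ _ _)

  *-distribˡ-∑ₗ : ∀ {a} {A : Set a} c (f : A → Carrier) xs → c * ∑ₗ xs f ≈ ∑ₗ xs (λ x → c * f x)
  *-distribˡ-∑ₗ c f []       = zeroʳ c
  *-distribˡ-∑ₗ c f (x ∷ xs) = trans (distribˡ c _ _) (+-congˡ (*-distribˡ-∑ₗ c f xs))

  ∑ₗ-∑-comm : ∀ {a} {A : Set a} (F : A → ℕ → Carrier) xs n → ∑ₗ xs (λ x → ∑< n (F x)) ≈ ∑[ i < n ] ∑ₗ xs (λ x → F x i)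
  ∑ₗ-∑-comm F []       n = sym (∑-zero n (λ _ _ → refl))
  ∑ₗ-∑-comm F (x ∷ xs) n = trans (+-congˡ (∑ₗ-∑-comm F xs n)) (sym (∑-distrib-+ n (F x) _))

  ∑ₗ-++ : ∀ {a} {A : Set a} (f : A → Carrier) xs ys → ∑ₗ (xs ++ ys) f ≈ ∑ₗ xs f + ∑ₗ ys f
  ∑ₗ-++ f []       ys = sym (+-identityˡ _)
  ∑ₗ-++ f (x ∷ xs) ys = trans (+-congˡ (∑ₗ-++ f xs ys)) (sym (+-assoc _ _ _))

  ∑ₗ-concat : ∀ {a} {A : Set a} (f : A → Carrier) xss → ∑ₗ (concat xss) f ≈ ∑ₗ xss (λ xs → ∑ₗ xs f)
  ∑ₗ-concat f []         = refl
  ∑ₗ-concat f (xs ∷ xss) = trans (∑ₗ-++ f xs (concat xss)) (+-congˡ (∑ₗ-concat f xss))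

  ∑ₗ-map : ∀ {a b} {A : Set a} {B : Set b} (g : B → Carrier) (f : A → B) xs → ∑ₗ (map f xs) g ≡ ∑ₗ xs (g ∘ f)
  ∑ₗ-map g f []       = Eq.refl
  ∑ₗ-map g f (x ∷ xs) = Eq.cong (g (f x) +_) (∑ₗ-map g f xs)

  ∑ₗ-applyUpTo : ∀ (f : ℕ → Carrier) g n → ∑ₗ (applyUpTo g n) f ≡ ∑< n (f ∘ g)
  ∑ₗ-applyUpTo f g zero    = Eq.refl
  ∑ₗ-applyUpTo f g (suc n) = Eq.cong (f (g 0) +_) (∑ₗ-applyUpTo f (g ∘ suc) n)

  infixl 7 _⊛_

  _⊛_ : (ℕ → Carrier) → (ℕ → Carrier) → ℕ → Carrier
  (f ⊛ g) n = ∑[ a < suc n ] (f a * g (n ∸ a))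

  ⊛-congˡ : ∀ {f f′} g → (∀ n → f n ≈ f′ n) → ∀ n → (f ⊛ g) n ≈ (f′ ⊛ g) n
  ⊛-congˡ g f≈f′ n = ∑-cong (suc n) (λ a → *-cong (f≈f′ a) (refl {x = g (n ∸ a)}))

  ⊛-congʳ : ∀ f {g g′} → (∀ n → g n ≈ g′ n) → ∀ n → (f ⊛ g) n ≈ (f ⊛ g′) n
  ⊛-congʳ f g≈g′ n = ∑-cong (suc n) (λ a → *-cong (refl {x = f a}) (g≈g′ (n ∸ a)))

  ⊛-assoc : ∀ f g h n → ((f ⊛ g) ⊛ h) n ≈ (f ⊛ (g ⊛ h)) n
  ⊛-assoc f g h n = begin
      ∑[ i < suc n ] (∑[ j < suc i ] (f j * g (i ∸ j)) * h (n ∸ i))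
    ≈⟨ ∑-cong (suc n) (λ i → *-distribʳ-∑ (h (n ∸ i)) (suc i) (λ j → f j * g (i ∸ j))) ⟩
      ∑[ i < suc n ] ∑[ j < suc i ] ((f j * g (i ∸ j)) * h (n ∸ i))
    ≈⟨ ∑-cong (suc n) (λ i → ∑-cong< (suc i) (λ j j<1+i → trans (*-assoc _ _ _)
          (reflexive (Eq.cong (λ d → f j * (g (i ∸ j) * h d)) (∸-split n (ℕP.<⇒≤pred j<1+i)))))) ⟩
      ∑[ i < suc n ] ∑[ j < suc i ] F j (i ∸ j)
    ≈⟨ ∑-antidiagonal F n ⟩
      ∑[ j < suc n ] ∑< (suc (n ∸ j)) (F j)
    ≈⟨ ∑-cong (suc n) (λ j → sym (*-distribˡ-∑ (f j) (suc (n ∸ j)) (λ l → g l * h (n ∸ j ∸ l)))) ⟩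
      ∑[ j < suc n ] (f j * (g ⊛ h) (n ∸ j))
    ∎
    where
    F : ℕ → ℕ → Carrier
    F j l = f j * (g l * h (n ∸ j ∸ l))
    ∸-split : ∀ k {i j} → j ≤ i → k ∸ i ≡ k ∸ j ∸ (i ∸ j)
    ∸-split k {i} {j} j≤i = Eq.sym (Eq.trans (ℕP.∸-+-assoc k j (i ∸ j)) (Eq.cong (k ∸_) (ℕP.m+[n∸m]≡n j≤i)))

  ⊛-constˡ : ∀ u c f n → u 0 ≈ c → (∀ a → u (suc a) ≈ 0#) → (u ⊛ f) n ≈ c * f n
  ⊛-constˡ u c f n u0≈c u+≈0 =
    trans (+-cong (*-congʳ u0≈c) (∑-zero n (λ a _ → trans (*-congʳ (u+≈0 a)) (zeroˡ _)))) (+-identityʳ _)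

  ⊛-identityʳ : ∀ f u n → u 0 ≈ 1# → (∀ a → u (suc a) ≈ 0#) → (f ⊛ u) n ≈ f n
  ⊛-identityʳ f u n u0≈1 u+≈0 = begin
      (f ⊛ u) n
    ≈⟨ ∑-last n (λ a → f a * u (n ∸ a)) ⟩
      ∑[ a < n ] (f a * u (n ∸ a)) + f n * u (n ∸ n)
    ≈⟨ +-cong (∑-zero n (λ a a<n → trans (*-congˡ (trans (reflexive (Eq.cong u (ℕP.+-∸-assoc 1 a<n))) (u+≈0 _))) (zeroʳ _)))
              (*-congˡ (trans (reflexive (Eq.cong u (ℕP.n∸n≡0 n))) u0≈1)) ⟩
      0# + f n * 1#
    ≈⟨ trans (+-identityˡ _) (*-identityʳ _) ⟩
      f n
    ∎

-- Formal power series form a commutative ring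

open Eq using (refl; sym; trans; cong; cong₂; subst)
open import Data.Integer as ℤ using (ℤ; +_; -[1+_]) renaming (_+_ to _+ℤ_; _*_ to _*ℤ_)

module ℤΣ = FiniteSums ℤP.+-*-commutativeRing
open ℤΣ using (∑<; ∑ₗ)

coeff₀ : PS → ℕ → PS
coeff₀ p i e = p (i ∷ e)

∑ₚ< : ℕ → (ℕ → PS) → PS
∑ₚ< n f e = ∑[ j < n ] f j e

coeff₀-*ₚ : ∀ p q k → coeff₀ (p *ₚ q) k ≈ₚ ∑ₚ< (suc k) (λ i → coeff₀ p i *ₚ coeff₀ q (k ∸ i))
coeff₀-*ₚ p q k e = begin
    ∑ₗ (concat (map (λ i → map (pair i) (splits e)) (upTo (suc k)))) term
  ≡⟨ ℤΣ.∑ₗ-concat term (map (λ i → map (pair i) (splits e)) (upTo (suc k))) ⟩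
    ∑ₗ (map (λ i → map (pair i) (splits e)) (upTo (suc k))) (λ ds → ∑ₗ ds term)
  ≡⟨ ℤΣ.∑ₗ-map (λ ds → ∑ₗ ds term) (λ i → map (pair i) (splits e)) (upTo (suc k)) ⟩
    ∑ₗ (upTo (suc k)) (λ i → ∑ₗ (map (pair i) (splits e)) term)
  ≡⟨ ℤΣ.∑ₗ-cong (upTo (suc k)) (λ i → ℤΣ.∑ₗ-map term (pair i) (splits e)) ⟩
    ∑ₗ (upTo (suc k)) (λ i → (coeff₀ p i *ₚ coeff₀ q (k ∸ i)) e)
  ≡⟨ ℤΣ.∑ₗ-applyUpTo (λ i → (coeff₀ p i *ₚ coeff₀ q (k ∸ i)) e) id (suc k) ⟩
    ∑ₚ< (suc k) (λ i → coeff₀ p i *ₚ coeff₀ q (k ∸ i)) e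
  ∎
  where
  open Eq.≡-Reasoning
  term : Mono × Mono → ℤ
  term (d , d′) = p d *ℤ q d′
  pair : ℕ → Mono × Mono → Mono × Mono
  pair i (d , d′) = (i ∷ d) , ((k ∸ i) ∷ d′)

*ₚ-cong : ∀ {p p′ q q′} → p ≈ₚ p′ → q ≈ₚ q′ → (p *ₚ q) ≈ₚ (p′ *ₚ q′)
*ₚ-cong p≈p′ q≈q′ e = ℤΣ.∑ₗ-cong (splits e) (λ (d , d′) → cong₂ _*ℤ_ (p≈p′ d) (q≈q′ d′))

*ₚ-distribʳ-∑ₚ : ∀ r n f → (∑ₚ< n f *ₚ r) ≈ₚ ∑ₚ< n (λ j → f j *ₚ r)
*ₚ-distribʳ-∑ₚ r n f e =
  trans (ℤΣ.∑ₗ-cong (splits e) (λ (d , d′) → ℤΣ.*-distribʳ-∑ (r d′) n (λ j → f j d)))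
        (ℤΣ.∑ₗ-∑-comm (λ (d , d′) j → f j d *ℤ r d′) (splits e) n)

*ₚ-distribˡ-∑ₚ : ∀ r n f → (r *ₚ ∑ₚ< n f) ≈ₚ ∑ₚ< n (λ j → r *ₚ f j)
*ₚ-distribˡ-∑ₚ r n f e =
  trans (ℤΣ.∑ₗ-cong (splits e) (λ (d , d′) → ℤΣ.*-distribˡ-∑ (r d) n (λ j → f j d′)))
        (ℤΣ.∑ₗ-∑-comm (λ (d , d′) j → r d *ℤ f j d′) (splits e) n)

*ₚ-assoc : ∀ p q r → ((p *ₚ q) *ₚ r) ≈ₚ (p *ₚ (q *ₚ r))
*ₚ-assoc p q r [] = cong (_+ℤ + 0) (begin
    (p [] *ℤ q [] +ℤ + 0) *ℤ r []
  ≡⟨ cong (_*ℤ r []) (ℤP.+-identityʳ (p [] *ℤ q [])) ⟩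
    p [] *ℤ q [] *ℤ r []
  ≡⟨ ℤP.*-assoc (p []) (q []) (r []) ⟩
    p [] *ℤ (q [] *ℤ r [])
  ≡⟨ cong (p [] *ℤ_) (sym (ℤP.+-identityʳ (q [] *ℤ r []))) ⟩
    p [] *ℤ (q [] *ℤ r [] +ℤ + 0)
  ∎)
  where open Eq.≡-Reasoning
*ₚ-assoc p q r (k ∷ e) = begin
    ((p *ₚ q) *ₚ r) (k ∷ e)
  ≡⟨ coeff₀-*ₚ (p *ₚ q) r k e ⟩
    ∑[ i < suc k ] (coeff₀ (p *ₚ q) i *ₚ r₀ (k ∸ i)) e
  ≡⟨ ℤΣ.∑-cong (suc k) (λ i → *ₚ-cong {q = r₀ (k ∸ i)} (coeff₀-*ₚ p q i) (λ _ → refl) e) ⟩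
    ∑[ i < suc k ] (∑ₚ< (suc i) (λ j → p₀ j *ₚ q₀ (i ∸ j)) *ₚ r₀ (k ∸ i)) e
  ≡⟨ ℤΣ.∑-cong (suc k) (λ i → *ₚ-distribʳ-∑ₚ (r₀ (k ∸ i)) (suc i) (λ j → p₀ j *ₚ q₀ (i ∸ j)) e) ⟩
    ∑[ i < suc k ] ∑[ j < suc i ] ((p₀ j *ₚ q₀ (i ∸ j)) *ₚ r₀ (k ∸ i)) e
  ≡⟨ ℤΣ.∑-cong (suc k) (λ i → ℤΣ.∑-cong< (suc i) (λ j j<1+i →
       trans (*ₚ-assoc (p₀ j) (q₀ (i ∸ j)) (r₀ (k ∸ i)) e)
             (cong (λ d → (p₀ j *ₚ (q₀ (i ∸ j) *ₚ r₀ d)) e) (∸-split k (ℕP.<⇒≤pred j<1+i))))) ⟩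
    ∑[ i < suc k ] ∑[ j < suc i ] F j (i ∸ j)
  ≡⟨ ℤΣ.∑-antidiagonal F k ⟩
    ∑[ j < suc k ] ∑< (suc (k ∸ j)) (F j)
  ≡⟨ ℤΣ.∑-cong (suc k) (λ j → sym (*ₚ-distribˡ-∑ₚ (p₀ j) (suc (k ∸ j)) (λ l → q₀ l *ₚ r₀ (k ∸ j ∸ l)) e)) ⟩
    ∑[ j < suc k ] (p₀ j *ₚ ∑ₚ< (suc (k ∸ j)) (λ l → q₀ l *ₚ r₀ (k ∸ j ∸ l))) e
  ≡⟨ ℤΣ.∑-cong (suc k) (λ j → *ₚ-cong {p₀ j} (λ _ → refl) (λ d → sym (coeff₀-*ₚ q r (k ∸ j) d)) e) ⟩
    ∑[ j < suc k ] (p₀ j *ₚ coeff₀ (q *ₚ r) (k ∸ j)) e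
  ≡⟨ sym (coeff₀-*ₚ p (q *ₚ r) k e) ⟩
    (p *ₚ (q *ₚ r)) (k ∷ e)
  ∎
  where
  open Eq.≡-Reasoning
  p₀ q₀ r₀ : ℕ → PS
  p₀ = coeff₀ p
  q₀ = coeff₀ q
  r₀ = coeff₀ r
  F : ℕ → ℕ → ℤ
  F j l = (p₀ j *ₚ (q₀ l *ₚ r₀ (k ∸ j ∸ l))) e
  ∸-split : ∀ k {i j} → j ≤ i → k ∸ i ≡ k ∸ j ∸ (i ∸ j)
  ∸-split k {i} {j} j≤i = sym (trans (ℕP.∸-+-assoc k j (i ∸ j)) (cong (k ∸_) (ℕP.m+[n∸m]≡n j≤i)))

*ₚ-comm : ∀ p q → (p *ₚ q) ≈ₚ (q *ₚ p)
*ₚ-comm p q []      = cong (_+ℤ + 0) (ℤP.*-comm (p []) (q []))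
*ₚ-comm p q (k ∷ e) = begin
    (p *ₚ q) (k ∷ e)
  ≡⟨ coeff₀-*ₚ p q k e ⟩
    ∑[ i < suc k ] (coeff₀ p i *ₚ coeff₀ q (k ∸ i)) e
  ≡⟨ ℤΣ.∑-cong< (suc k) (λ i i<1+k → trans (*ₚ-comm (coeff₀ p i) (coeff₀ q (k ∸ i)) e)
       (cong (λ j → (coeff₀ q (k ∸ i) *ₚ coeff₀ p j) e) (sym (ℕP.m∸[m∸n]≡n (ℕP.<⇒≤pred i<1+k))))) ⟩
    ∑[ i < suc k ] f (k ∸ i)
  ≡⟨ sym (ℤΣ.∑-reverse k f) ⟩
    ∑< (suc k) f
  ≡⟨ sym (coeff₀-*ₚ q p k e) ⟩
    (q *ₚ p) (k ∷ e)
  ∎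
  where
  open Eq.≡-Reasoning
  f : ℕ → ℤ
  f i = (coeff₀ q i *ₚ coeff₀ p (k ∸ i)) e

*ₚ-zeroˡ : ∀ p → (0ₚ *ₚ p) ≈ₚ 0ₚ
*ₚ-zeroˡ p e = ℤΣ.∑ₗ-zero (splits e) (λ (_ , d′) → ℤP.*-zeroˡ (p d′))

*ₚ-identityˡ : ∀ p → (1ₚ *ₚ p) ≈ₚ p
*ₚ-identityˡ p []      = trans (ℤP.+-identityʳ _) (ℤP.*-identityˡ (p []))
*ₚ-identityˡ p (k ∷ e) = begin
    (1ₚ *ₚ p) (k ∷ e)
  ≡⟨ coeff₀-*ₚ 1ₚ p k e ⟩
    (1ₚ *ₚ coeff₀ p k) e +ℤ ∑[ i < k ] (0ₚ *ₚ coeff₀ p (k ∸ suc i)) e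
  ≡⟨ cong₂ _+ℤ_ (*ₚ-identityˡ (coeff₀ p k) e) (ℤΣ.∑-zero k (λ i _ → *ₚ-zeroˡ (coeff₀ p (k ∸ suc i)) e)) ⟩
    p (k ∷ e) +ℤ + 0
  ≡⟨ ℤP.+-identityʳ _ ⟩
    p (k ∷ e)
  ∎
  where open Eq.≡-Reasoning

*ₚ-distribˡ-+ₚ : ∀ p q r → (p *ₚ (q +ₚ r)) ≈ₚ (p *ₚ q +ₚ p *ₚ r)
*ₚ-distribˡ-+ₚ p q r e =
  trans (ℤΣ.∑ₗ-cong (splits e) (λ (d , d′) → ℤP.*-distribˡ-+ (p d) (q d′) (r d′)))
        (ℤΣ.∑ₗ-distrib-+ (λ (d , d′) → p d *ℤ q d′) (λ (d , d′) → p d *ℤ r d′) (splits e))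

open Algebra.Structures {A = PS} _≈ₚ_ using (IsCommutativeRing)

+ₚ-*ₚ-isCommutativeRing : IsCommutativeRing _+ₚ_ _*ₚ_ -ₚ_ 0ₚ 1ₚ
+ₚ-*ₚ-isCommutativeRing = record
  { isRing = record
    { +-isAbelianGroup = record
      { isGroup = record
        { isMonoid = record
          { isSemigroup = record
            { isMagma = record
              { isEquivalence = record
                { refl  = λ _ → refl
                ; sym   = λ p≈q e → sym (p≈q e)
                ; trans = ≈ₚ-trans
                }
              ; ∙-cong = λ p≈p′ q≈q′ e → cong₂ _+ℤ_ (p≈p′ e) (q≈q′ e)
              }
            ; assoc = λ p q r e → ℤP.+-assoc (p e) (q e) (r e)
            }
          ; identity = (λ p e → ℤP.+-identityˡ (p e)) , (λ p e → ℤP.+-identityʳ (p e))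
          }
        ; inverse = (λ p e → ℤP.+-inverseˡ (p e)) , (λ p e → ℤP.+-inverseʳ (p e))
        ; ⁻¹-cong = λ p≈q e → cong ℤ.-_ (p≈q e)
        }
      ; comm = λ p q e → ℤP.+-comm (p e) (q e)
      }
    ; *-cong     = *ₚ-cong
    ; *-assoc    = *ₚ-assoc
    ; *-identity = *ₚ-identityˡ , (λ p → ≈ₚ-trans (*ₚ-comm p 1ₚ) (*ₚ-identityˡ p))
    ; distrib    = *ₚ-distribˡ-+ₚ , distribʳ
    }
  ; *-comm = *ₚ-comm
  }
  where
  ≈ₚ-trans : ∀ {p q r} → p ≈ₚ q → q ≈ₚ r → p ≈ₚ r
  ≈ₚ-trans p≈q q≈r e = trans (p≈q e) (q≈r e)
  distribʳ : ∀ p q r → ((q +ₚ r) *ₚ p) ≈ₚ (q *ₚ p +ₚ r *ₚ p)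
  distribʳ p q r e = begin
      ((q +ₚ r) *ₚ p) e       ≡⟨ *ₚ-comm (q +ₚ r) p e ⟩
      (p *ₚ (q +ₚ r)) e       ≡⟨ *ₚ-distribˡ-+ₚ p q r e ⟩
      (p *ₚ q +ₚ p *ₚ r) e    ≡⟨ cong₂ _+ℤ_ (*ₚ-comm p q e) (*ₚ-comm p r e) ⟩
      (q *ₚ p +ₚ r *ₚ p) e    ∎
    where open Eq.≡-Reasoning

+ₚ-*ₚ-commutativeRing : CommutativeRing _ _
+ₚ-*ₚ-commutativeRing = record { isCommutativeRing = +ₚ-*ₚ-isCommutativeRing }

-- Order of a power series

Ord≥ : ℕ → PS → Set
Ord≥ n p = ∀ e → deg e < n → p e ≡ + 0

splits-deg : ∀ e → All (λ (d , d′) → deg d ℕ.+ deg d′ ≡ deg e) (splits e)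
splits-deg []      = refl ∷ []
splits-deg (k ∷ e) = concat⁺ (map⁺ (applyUpTo⁺₁ id (suc k) (λ {i} i<1+k →
  map⁺ (All.map (λ {(d , d′)} eq → degs i (deg d) (deg d′) (ℕP.<⇒≤pred i<1+k) eq) (splits-deg e)))))
  where
  open import Algebra.Properties.CommutativeSemigroup ℕP.+-commutativeSemigroup using () renaming (interchange to +-interchange)
  degs : ∀ i a b → i ≤ k → a ℕ.+ b ≡ deg e → (i ℕ.+ a) ℕ.+ ((k ∸ i) ℕ.+ b) ≡ k ℕ.+ deg e
  degs i a b i≤k eq = trans (+-interchange i a (k ∸ i) b) (cong₂ ℕ._+_ (ℕP.m+[n∸m]≡n i≤k) eq)

Ord≥-*ₚ : ∀ {a b p q} → Ord≥ a p → Ord≥ b q → Ord≥ (a ℕ.+ b) (p *ₚ q)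
Ord≥-*ₚ {a} {b} {p} {q} ord-p ord-q e deg<a+b =
  ℤΣ.∑ₗ-zeroᴬ (splits e) (All.map (λ {(d , d′)} → term d d′) (splits-deg e))
  where
  term : ∀ d d′ → deg d ℕ.+ deg d′ ≡ deg e → p d *ℤ q d′ ≡ + 0
  term d d′ eq with deg d ℕP.<? a | deg d′ ℕP.<? b
  ... | yes d<a | _       = trans (cong (_*ℤ q d′) (ord-p d d<a)) (ℤP.*-zeroˡ (q d′))
  ... | no _    | yes d′<b = trans (cong (p d *ℤ_) (ord-q d′ d′<b)) (ℤP.*-zeroʳ (p d))
  ... | no d≮a  | no d′≮b  =
    contradiction (subst (a ℕ.+ b ≤_) eq (ℕP.+-mono-≤ (ℕP.≮⇒≥ d≮a) (ℕP.≮⇒≥ d′≮b))) (ℕP.<⇒≱ deg<a+b)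

Ord≥-^ₚ : ∀ {z} a → Ord≥ 1 z → Ord≥ a (z ^ₚ a)
Ord≥-^ₚ zero    ord-z = λ _ ()
Ord≥-^ₚ (suc a) ord-z = Ord≥-*ₚ {1} {a} ord-z (Ord≥-^ₚ a ord-z)

isUnitAt-deg0 : ∀ j e → deg e ≡ 0 → isUnitAt j e ≡ false
isUnitAt-deg0 j       []      _  = refl
isUnitAt-deg0 zero    (k ∷ e) eq rewrite ℕP.m+n≡0⇒m≡0 k eq = refl
isUnitAt-deg0 (suc j) (k ∷ e) eq rewrite ℕP.m+n≡0⇒m≡0 k eq = isUnitAt-deg0 j e (ℕP.m+n≡0⇒n≡0 k eq)

Ord≥-var : ∀ j → Ord≥ 1 (var j)
Ord≥-var j e deg<1 rewrite isUnitAt-deg0 j e (ℕP.n<1⇒n≡0 deg<1) = refl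

Ord≥-neg : ∀ {n p} → Ord≥ n p → Ord≥ n (-ₚ p)
Ord≥-neg ord-p e deg<n = cong ℤ.-_ (ord-p e deg<n)

Ord≥-sumₚ : ∀ {n} {A : Set} (f : A → PS) xs → All (λ x → Ord≥ n (f x)) xs → Ord≥ n (sumₚ (map f xs))
Ord≥-sumₚ f []       []                e deg<n = refl
Ord≥-sumₚ f (x ∷ xs) (ord-fx ∷ ord-fxs) e deg<n = cong₂ _+ℤ_ (ord-fx e deg<n) (Ord≥-sumₚ f xs ord-fxs e deg<n)

Alphabet≥1 : Alphabet → Set
Alphabet≥1 = All (λ (_ , z) → Ord≥ 1 z)

Ord≥-h : ∀ m Z → Alphabet≥1 Z → Ord≥ m (h m Z)
Ord≥-h zero    Z                 _             = λ _ ()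
Ord≥-h (suc m) []                _             = λ _ _ → refl
Ord≥-h (suc m) ((pos , z) ∷ Z)   (ord-z ∷ ord-Z) =
  Ord≥-sumₚ (λ a → (z ^ₚ a) *ₚ h (suc m ∸ a) Z) (upTo (suc (suc m))) (applyUpTo⁺₁ id (suc (suc m)) (λ {a} a<2+m →
    subst (λ n → Ord≥ n ((z ^ₚ a) *ₚ h (suc m ∸ a) Z)) (ℕP.m+[n∸m]≡n (ℕP.<⇒≤pred a<2+m))
          (Ord≥-*ₚ {a} (Ord≥-^ₚ a ord-z) (Ord≥-h (suc m ∸ a) Z ord-Z))))
Ord≥-h (suc m) ((neg , z) ∷ Z)   (ord-z ∷ ord-Z) e deg<1+m =
  cong₂ _+ℤ_ (Ord≥-h (suc m) Z ord-Z e deg<1+m) (Ord≥-neg (Ord≥-*ₚ {1} {m} ord-z (Ord≥-h m Z ord-Z)) e deg<1+m)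

open CommutativeRing +ₚ-*ₚ-commutativeRing using (_≈_; _+_; _*_; -_; 0#; 1#)
module R = CommutativeRing +ₚ-*ₚ-commutativeRing
module PΣ = FiniteSums +ₚ-*ₚ-commutativeRing
open PΣ using (_⊛_)

*-congˡ : ∀ a {b c} → b ≈ c → a * b ≈ a * c
*-congˡ a = R.*-congˡ {a}

*-congʳ : ∀ c {a b} → a ≈ b → a * c ≈ b * c
*-congʳ c = R.*-congʳ {c}

+-congˡ : ∀ a {b c} → b ≈ c → a + b ≈ a + c
+-congˡ a = R.+-congˡ {a}

∑-eval : ∀ n f e → PΣ.∑< n f e ≡ ∑ₚ< n f e
∑-eval zero    f e = refl
∑-eval (suc n) f e = cong (f 0 e +ℤ_) (∑-eval n (f ∘ suc) e)

-- Formally convergent sums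

OrderedFamily : (ℕ → PS) → Set
OrderedFamily f = ∀ n → Ord≥ n (f n)

Σ∞-unfold : ∀ f e → Σ∞ f e ≡ ∑[ n < suc (deg e) ] f n e
Σ∞-unfold f e = ℤΣ.∑ₗ-applyUpTo (λ n → f n e) id (suc (deg e))

Σ∞-truncate : ∀ f → OrderedFamily f → ∀ e N → deg e ≤ N → Σ∞ f e ≡ ∑[ n < suc N ] f n e
Σ∞-truncate f ord-f e N deg≤N = begin
    Σ∞ f e
  ≡⟨ Σ∞-unfold f e ⟩
    ∑< (suc (deg e)) fₑ
  ≡⟨ sym (ℤΣ.∑-padʳ (suc (deg e)) (N ∸ deg e) fₑ (λ n deg<n _ → ord-f n e deg<n)) ⟩
    ∑< (suc (deg e) ℕ.+ (N ∸ deg e)) fₑ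
  ≡⟨ cong (λ n → ∑< (suc n) fₑ) (ℕP.m+[n∸m]≡n deg≤N) ⟩
    ∑< (suc N) fₑ
  ∎
  where
  open Eq.≡-Reasoning
  fₑ : ℕ → ℤ
  fₑ n = f n e

Σ∞-cong : ∀ {f g} → (∀ n → f n ≈ g n) → Σ∞ f ≈ Σ∞ g
Σ∞-cong f≈g e = ℤΣ.∑ₗ-cong (upTo (suc (deg e))) (λ n → f≈g n e)

*-distribˡ-Σ∞ : ∀ c f → OrderedFamily f → c * Σ∞ f ≈ Σ∞ (λ n → c * f n)
*-distribˡ-Σ∞ c f ord-f e = begin
    ∑ₗ (splits e) (λ (d , d′) → c d *ℤ Σ∞ f d′)
  ≡⟨ ℤΣ.∑ₗ-congᴬ (splits e) (All.map (λ {(d , d′)} eq → cong (c d *ℤ_)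
       (Σ∞-truncate f ord-f d′ (deg e) (subst (deg d′ ≤_) eq (ℕP.m≤n+m (deg d′) (deg d))))) (splits-deg e)) ⟩
    ∑ₗ (splits e) (λ (d , d′) → c d *ℤ ∑[ n < suc (deg e) ] f n d′)
  ≡⟨ ℤΣ.∑ₗ-cong (splits e) (λ (d , d′) → ℤΣ.*-distribˡ-∑ (c d) (suc (deg e)) (λ n → f n d′)) ⟩
    ∑ₗ (splits e) (λ (d , d′) → ∑[ n < suc (deg e) ] (c d *ℤ f n d′))
  ≡⟨ ℤΣ.∑ₗ-∑-comm (λ (d , d′) n → c d *ℤ f n d′) (splits e) (suc (deg e)) ⟩
    ∑[ n < suc (deg e) ] (c * f n) e
  ≡⟨ sym (Σ∞-unfold (λ n → c * f n) e) ⟩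
    Σ∞ (λ n → c * f n) e
  ∎
  where open Eq.≡-Reasoning

Σ∞-antidiagonal : ∀ (F : ℕ → ℕ → PS) → (∀ m a → Ord≥ (m ℕ.+ a) (F m a)) →
  Σ∞ (λ b → PΣ.∑[ m < suc b ] F m (b ∸ m)) ≈ Σ∞ (λ m → Σ∞ (F m))
Σ∞-antidiagonal F ord-F e = begin
    Σ∞ (λ b → PΣ.∑[ m < suc b ] F m (b ∸ m)) e
  ≡⟨ Σ∞-unfold (λ b → PΣ.∑[ m < suc b ] F m (b ∸ m)) e ⟩
    ∑[ b < suc D ] (PΣ.∑[ m < suc b ] F m (b ∸ m)) e
  ≡⟨ ℤΣ.∑-cong (suc D) (λ b → ∑-eval (suc b) (λ m → F m (b ∸ m)) e) ⟩
    ∑[ b < suc D ] ∑[ m < suc b ] F m (b ∸ m) e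
  ≡⟨ ℤΣ.∑-antidiagonal (λ m a → F m a e) D ⟩
    ∑[ m < suc D ] ∑[ a < suc (D ∸ m) ] F m a e
  ≡⟨ ℤΣ.∑-cong< (suc D) (λ m m<1+D → column m (ℕP.<⇒≤pred m<1+D)) ⟩
    ∑[ m < suc D ] Σ∞ (F m) e
  ≡⟨ sym (Σ∞-unfold (λ m → Σ∞ (F m)) e) ⟩
    Σ∞ (λ m → Σ∞ (F m)) e
  ∎
  where
  open Eq.≡-Reasoning
  D = deg e
  column : ∀ m → m ≤ D → ∑[ a < suc (D ∸ m) ] F m a e ≡ Σ∞ (F m) e
  column m m≤D = begin
      ∑[ a < suc (D ∸ m) ] F m a e
    ≡⟨ sym (ℤΣ.∑-padʳ (suc (D ∸ m)) m (λ a → F m a e)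
         (λ a D-m<a _ → ord-F m a e (ℕP.≤-<-trans (ℕP.m≤n+m∸n D m) (ℕP.+-monoʳ-< m D-m<a)))) ⟩
      ∑[ a < suc (D ∸ m) ℕ.+ m ] F m a e
    ≡⟨ cong (λ n → ∑[ a < suc n ] F m a e) (ℕP.m∸n+n≡m m≤D) ⟩
      ∑[ a < suc D ] F m a e
    ≡⟨ sym (Σ∞-unfold (F m) e) ⟩
      Σ∞ (F m) e
    ∎

-- Complete homogeneous functions of alphabets

hSeq : Alphabet → ℕ → PS
hSeq Z m = h m Z

powers : PS → ℕ → PS
powers z a = z ^ₚ a

oneMinus : PS → ℕ → PS
oneMinus z zero          = 1ₚ
oneMinus z (suc zero)    = -ₚ z
oneMinus z (suc (suc _)) = 0ₚ

h-pos-letter : ∀ z Z m → h m ((pos , z) ∷ Z) ≡ (powers z ⊛ hSeq Z) m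
h-pos-letter z Z zero    = PΣ.∑ₗ-applyUpTo (λ a → (z ^ₚ a) *ₚ h (0 ∸ a) Z) id 1
h-pos-letter z Z (suc m) = PΣ.∑ₗ-applyUpTo (λ a → (z ^ₚ a) *ₚ h (suc m ∸ a) Z) id (suc (suc m))

h-neg-letter : ∀ z Z m → h m ((neg , z) ∷ Z) ≈ (oneMinus z ⊛ hSeq Z) m
h-neg-letter z Z zero    = R.sym (R.trans (R.+-identityʳ (1# * h 0 Z)) (R.*-identityˡ (h 0 Z)))
h-neg-letter z Z (suc m) = R.sym (begin
    1# * h (suc m) Z + ((- z) * h m Z + PΣ.∑[ a < m ] (0ₚ * h (m ∸ suc a) Z))
  ≈⟨ R.+-cong (R.*-identityˡ (h (suc m) Z))
              (R.+-cong (R.sym (-‿distribˡ-* z (h m Z))) (PΣ.∑-zero m (λ a _ → R.zeroˡ (h (m ∸ suc a) Z)))) ⟩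
    h (suc m) Z + (- (z * h m Z) + 0#)
  ≈⟨ +-congˡ (h (suc m) Z) (R.+-identityʳ (- (z * h m Z))) ⟩
    h (suc m) Z + - (z * h m Z)
  ∎)
  where
  open import Relation.Binary.Reasoning.Setoid R.setoid
  open import Algebra.Properties.Ring R.ring using (-‿distribˡ-*)

h-++ : ∀ Z W m → h m (Z ++ W) ≈ (hSeq Z ⊛ hSeq W) m
h-++ []              W m = R.sym (R.trans (PΣ.⊛-constˡ (hSeq []) 1# (hSeq W) m R.refl (λ _ → R.refl)) (R.*-identityˡ (h m W)))
h-++ ((pos , z) ∷ Z) W m = begin
    h m ((pos , z) ∷ (Z ++ W))
  ≈⟨ R.reflexive (h-pos-letter z (Z ++ W) m) ⟩
    (powers z ⊛ hSeq (Z ++ W)) m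
  ≈⟨ PΣ.⊛-congʳ (powers z) (λ n → h-++ Z W n) m ⟩
    (powers z ⊛ (hSeq Z ⊛ hSeq W)) m
  ≈⟨ R.sym (PΣ.⊛-assoc (powers z) (hSeq Z) (hSeq W) m) ⟩
    ((powers z ⊛ hSeq Z) ⊛ hSeq W) m
  ≈⟨ PΣ.⊛-congˡ (hSeq W) (λ n → R.reflexive (sym (h-pos-letter z Z n))) m ⟩
    (hSeq ((pos , z) ∷ Z) ⊛ hSeq W) m
  ∎
  where open import Relation.Binary.Reasoning.Setoid R.setoid
h-++ ((neg , z) ∷ Z) W m = begin
    h m ((neg , z) ∷ (Z ++ W))
  ≈⟨ h-neg-letter z (Z ++ W) m ⟩
    (oneMinus z ⊛ hSeq (Z ++ W)) m
  ≈⟨ PΣ.⊛-congʳ (oneMinus z) (λ n → h-++ Z W n) m ⟩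
    (oneMinus z ⊛ (hSeq Z ⊛ hSeq W)) m
  ≈⟨ R.sym (PΣ.⊛-assoc (oneMinus z) (hSeq Z) (hSeq W) m) ⟩
    ((oneMinus z ⊛ hSeq Z) ⊛ hSeq W) m
  ≈⟨ PΣ.⊛-congˡ (hSeq W) (λ n → R.sym (h-neg-letter z Z n)) m ⟩
    (hSeq ((neg , z) ∷ Z) ⊛ hSeq W) m
  ∎
  where open import Relation.Binary.Reasoning.Setoid R.setoid

oneMinus⊛powers : ∀ z n → (oneMinus z ⊛ powers z) n ≈ 1Z n
oneMinus⊛powers z zero    = R.trans (R.+-identityʳ (1# * 1#)) (R.*-identityˡ 1#)
oneMinus⊛powers z (suc n) = begin
    1# * (z * z ^ₚ n) + ((- z) * z ^ₚ n + PΣ.∑[ a < n ] (0ₚ * z ^ₚ (n ∸ suc a)))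
  ≈⟨ R.+-cong (R.*-identityˡ (z * z ^ₚ n))
              (R.+-cong (R.sym (-‿distribˡ-* z (z ^ₚ n))) (PΣ.∑-zero n (λ a _ → R.zeroˡ (z ^ₚ (n ∸ suc a))))) ⟩
    z * z ^ₚ n + (- (z * z ^ₚ n) + 0#)
  ≈⟨ +-congˡ (z * z ^ₚ n) (R.+-identityʳ (- (z * z ^ₚ n))) ⟩
    z * z ^ₚ n + - (z * z ^ₚ n)
  ≈⟨ R.-‿inverseʳ (z * z ^ₚ n) ⟩
    0#
  ∎
  where
  open import Relation.Binary.Reasoning.Setoid R.setoid
  open import Algebra.Properties.Ring R.ring using (-‿distribˡ-*)

h-remove-letter : ∀ Y z b → h b Y ≈ (hSeq (Y ++ (neg , z) ∷ []) ⊛ powers z) b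
h-remove-letter Y z b = R.sym (begin
    (hSeq (Y ++ (neg , z) ∷ []) ⊛ powers z) b
  ≈⟨ PΣ.⊛-congˡ (powers z) (λ n → h-++ Y ((neg , z) ∷ []) n) b ⟩
    ((hSeq Y ⊛ hSeq ((neg , z) ∷ [])) ⊛ powers z) b
  ≈⟨ PΣ.⊛-assoc (hSeq Y) (hSeq ((neg , z) ∷ [])) (powers z) b ⟩
    (hSeq Y ⊛ (hSeq ((neg , z) ∷ []) ⊛ powers z)) b
  ≈⟨ PΣ.⊛-identityʳ (hSeq Y) δ b (δ≈1Z 0) (λ a → δ≈1Z (suc a)) ⟩
    h b Y
  ∎)
  where
  open import Relation.Binary.Reasoning.Setoid R.setoid
  δ : ℕ → PS
  δ = hSeq ((neg , z) ∷ []) ⊛ powers z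
  δ≈1Z : ∀ n → δ n ≈ 1Z n
  δ≈1Z n = R.trans (PΣ.⊛-congˡ (powers z)
                     (λ k → R.trans (h-neg-letter z [] k) (PΣ.⊛-identityʳ (oneMinus z) (hSeq []) k R.refl (λ _ → R.refl))) n)
                   (oneMinus⊛powers z n)

-- Determinants

det-cong : ∀ n {M N : Fin n → Fin n → PS} → (∀ i j → M i j ≈ N i j) → det M ≈ det N
det-cong zero    M≈N = R.refl
det-cong (suc n) M≈N = PΣ.∑ₗ-cong (allFin (suc n)) (λ j →
  R.*-cong (*-congˡ ((-ₚ 1ₚ) ^ₚ toℕ j) (M≈N fzero j)) (det-cong n (λ i k → M≈N (fsuc i) (punchIn j k))))

prodₚ-allFin : ∀ n (c : Fin n → PS) → prodₚ (map c (allFin n)) ≡ prodₚ (tabulate c)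
prodₚ-allFin n c = cong prodₚ (ListP.map-tabulate id c)

det-scaleRows : ∀ n (c : Fin n → PS) (M : Fin n → Fin n → PS) →
  det (λ i j → c i * M i j) ≈ prodₚ (map c (allFin n)) * det M
det-scaleRows zero    c M = R.sym (R.*-identityˡ 1#)
det-scaleRows (suc n) c M = begin
    PΣ.∑ₗ (allFin (suc n)) (λ j → (sgn j * (c fzero * M fzero j)) * det (λ i k → c (fsuc i) * minor j i k))
  ≈⟨ PΣ.∑ₗ-cong (allFin (suc n)) (λ j → *-congˡ (sgn j * (c fzero * M fzero j)) (det-scaleRows n (c ∘ fsuc) (minor j))) ⟩
    PΣ.∑ₗ (allFin (suc n)) (λ j → (sgn j * (c fzero * M fzero j)) * (cs * det (minor j)))
  ≈⟨ PΣ.∑ₗ-cong (allFin (suc n)) (λ j → rearrange (sgn j) (c fzero) (M fzero j) cs (det (minor j))) ⟩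
    PΣ.∑ₗ (allFin (suc n)) (λ j → (c fzero * cs) * ((sgn j * M fzero j) * det (minor j)))
  ≈⟨ R.sym (PΣ.*-distribˡ-∑ₗ (c fzero * cs) (λ j → (sgn j * M fzero j) * det (minor j)) (allFin (suc n))) ⟩
    (c fzero * cs) * det M
  ≈⟨ *-congʳ (det M) (R.reflexive (sym (trans (prodₚ-allFin (suc n) c) (cong (c fzero *_) (sym (prodₚ-allFin n (c ∘ fsuc))))))) ⟩
    prodₚ (map c (allFin (suc n))) * det M
  ∎
  where
  open import Relation.Binary.Reasoning.Setoid R.setoid
  open import Algebra.Properties.CommutativeSemigroup R.*-commutativeSemigroup using (interchange; x∙yz≈y∙xz)
  sgn : Fin (suc n) → PS
  sgn j = (-ₚ 1ₚ) ^ₚ toℕ j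
  minor : Fin (suc n) → Fin n → Fin n → PS
  minor j i k = M (fsuc i) (punchIn j k)
  cs : PS
  cs = prodₚ (map (c ∘ fsuc) (allFin n))
  rearrange : ∀ s a m r d → (s * (a * m)) * (r * d) ≈ (a * r) * ((s * m) * d)
  rearrange s a m r d = R.trans (*-congʳ (r * d) (x∙yz≈y∙xz s a m)) (interchange a (s * m) r d)

-- The entries of the two determinants

flagFactor : PS → ℕ → PS
flagFactor β t = 1ₚ -ₚ β *ₚ 𝕩 t

flagProduct : PS → List ℕ → ZS
flagProduct β ts = foldr (λ t acc → (constZ (flagFactor β t) ⋆ geomZ (𝕩 t)) ⋆ acc) 1Z ts

xLetters : List ℕ → Alphabet
xLetters ts = map (λ t → pos , 𝕩 t) ts

⋆≡⊛ : ∀ f g n → (f ⋆ g) n ≡ (f ⊛ g) n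
⋆≡⊛ f g n = PΣ.∑ₗ-applyUpTo (λ a → f a *ₚ g (n ∸ a)) id (suc n)

flagProduct-coeff : ∀ β ts n → flagProduct β ts n ≈ prodₚ (map (flagFactor β) ts) * h n (xLetters ts)
flagProduct-coeff β []       zero    = R.sym (R.*-identityˡ 1#)
flagProduct-coeff β []       (suc n) = R.sym (R.*-identityˡ 0#)
flagProduct-coeff β (t ∷ ts) n = begin
    ((constZ c ⋆ geomZ x) ⋆ flagProduct β ts) n
  ≈⟨ R.reflexive (⋆≡⊛ (constZ c ⋆ geomZ x) (flagProduct β ts) n) ⟩
    ((constZ c ⋆ geomZ x) ⊛ flagProduct β ts) n
  ≈⟨ PΣ.⊛-congˡ (flagProduct β ts) c⋆xᵃ≈cxᵃ n ⟩
    ((λ a → c * x ^ₚ a) ⊛ flagProduct β ts) n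
  ≈⟨ PΣ.⊛-congʳ (λ a → c * x ^ₚ a) (flagProduct-coeff β ts) n ⟩
    PΣ.∑[ a < suc n ] ((c * x ^ₚ a) * (cs * h (n ∸ a) (xLetters ts)))
  ≈⟨ PΣ.∑-cong (suc n) (λ a → interchange c (x ^ₚ a) cs (h (n ∸ a) (xLetters ts))) ⟩
    PΣ.∑[ a < suc n ] ((c * cs) * (x ^ₚ a * h (n ∸ a) (xLetters ts)))
  ≈⟨ R.sym (PΣ.*-distribˡ-∑ (c * cs) (suc n) (λ a → x ^ₚ a * h (n ∸ a) (xLetters ts))) ⟩
    (c * cs) * (powers x ⊛ hSeq (xLetters ts)) n
  ≈⟨ *-congˡ (c * cs) (R.reflexive (sym (h-pos-letter x (xLetters ts) n))) ⟩
    (c * cs) * h n (xLetters (t ∷ ts))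
  ∎
  where
  open import Relation.Binary.Reasoning.Setoid R.setoid
  open import Algebra.Properties.CommutativeSemigroup R.*-commutativeSemigroup using (interchange)
  c x cs : PS
  c  = flagFactor β t
  x  = 𝕩 t
  cs = prodₚ (map (flagFactor β) ts)
  c⋆xᵃ≈cxᵃ : ∀ a → (constZ c ⋆ geomZ x) a ≈ c * x ^ₚ a
  c⋆xᵃ≈cxᵃ a = R.trans (R.reflexive (⋆≡⊛ (constZ c) (geomZ x) a))
                       (PΣ.⊛-constˡ (constZ c) c (geomZ x) a R.refl (λ _ → R.refl))

flagProduct-coeffℤ : ∀ β ts k → coeffZ (flagProduct β ts) k ≈ prodₚ (map (flagFactor β) ts) * hℤ k (xLetters ts)
flagProduct-coeffℤ β ts (+ n)    = flagProduct-coeff β ts n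
flagProduct-coeffℤ β ts -[1+ n ] = R.sym (R.zeroʳ (prodₚ (map (flagFactor β) ts)))

𝔊-expand : ∀ s k β →
  𝔊 s 1 k β ≈ Σ∞ (λ a → β ^ₚ a * (prodₚ (map (flagFactor β) (range 1 s)) * hℤ (k +ℤ + a) (xA 1 s)))
𝔊-expand s k β = Σ∞-cong (λ a → *-congˡ (β ^ₚ a) (flagProduct-coeffℤ β (range 1 s) (k +ℤ + a)))

h⊖-flagExpansion : ∀ k s Y β → Alphabet≥1 Y → Ord≥ 1 β →
  prodₚ (map (flagFactor β) (range 1 s)) * h⊖ k (xA 1 s) Y
    ≈ Σ∞ (λ m → h m (Y ++ (neg , β) ∷ []) * 𝔊 s 1 (k +ℤ + m) β)
h⊖-flagExpansion k s Y β ord-Y ord-β = begin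
    cX * Σ∞ (λ b → hℤ (k +ℤ + b) X * h b Y)
  ≈⟨ *-distribˡ-Σ∞ cX (λ b → hℤ (k +ℤ + b) X * h b Y) (λ b → Ord≥-*ₚ {0} {p = hℤ (k +ℤ + b) X} (λ _ ()) (Ord≥-h b Y ord-Y)) ⟩
    Σ∞ (λ b → cX * (hℤ (k +ℤ + b) X * h b Y))
  ≈⟨ Σ∞-cong remove-β ⟩
    Σ∞ (λ b → PΣ.∑[ m < suc b ] F m (b ∸ m))
  ≈⟨ Σ∞-antidiagonal F (λ m a → Ord≥-*ₚ {m} (Ord≥-h m Y′ ord-Y′) (ord-G m a)) ⟩
    Σ∞ (λ m → Σ∞ (F m))
  ≈⟨ Σ∞-cong (λ m → R.sym (R.trans (*-congˡ (h m Y′) (𝔊-expand s (k +ℤ + m) β)) (*-distribˡ-Σ∞ (h m Y′) (G m) (ord-G m)))) ⟩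
    Σ∞ (λ m → h m Y′ * 𝔊 s 1 (k +ℤ + m) β)
  ∎
  where
  open import Relation.Binary.Reasoning.Setoid R.setoid
  open import Algebra.Properties.CommutativeSemigroup R.*-commutativeSemigroup using (x∙yz≈y∙xz)
  X Y′ : Alphabet
  X  = xA 1 s
  Y′ = Y ++ (neg , β) ∷ []
  ord-Y′ : Alphabet≥1 Y′
  ord-Y′ = ++⁺ ord-Y (ord-β ∷ [])
  cX : PS
  cX = prodₚ (map (flagFactor β) (range 1 s))
  G F : ℕ → ℕ → PS
  G m a = β ^ₚ a * (cX * hℤ ((k +ℤ + m) +ℤ + a) X)
  F m a = h m Y′ * G m a
  ord-G : ∀ m a → Ord≥ a (G m a)
  ord-G m a = subst (λ n → Ord≥ n (G m a)) (ℕP.+-identityʳ a) (Ord≥-*ₚ {a} {0} {q = cX * hℤ ((k +ℤ + m) +ℤ + a) X} (Ord≥-^ₚ a ord-β) (λ _ ()))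
  reindex : ∀ {m b} → m ≤ b → (k +ℤ + m) +ℤ + (b ∸ m) ≡ k +ℤ + b
  reindex {m} {b} m≤b = trans (ℤP.+-assoc k (+ m) (+ (b ∸ m)))
    (cong (k +ℤ_) (trans (sym (ℤP.pos-+ m (b ∸ m))) (cong +_ (ℕP.m+[n∸m]≡n m≤b))))
  rotate : ∀ a p c q → a * (p * (c * q)) ≈ c * (q * (a * p))
  rotate a p c q = R.trans (*-congˡ a (x∙yz≈y∙xz p c q))
    (R.trans (x∙yz≈y∙xz a c (p * q)) (*-congˡ c (R.trans (R.sym (R.*-assoc a p q)) (R.*-comm (a * p) q))))
  remove-β : ∀ b → cX * (hℤ (k +ℤ + b) X * h b Y) ≈ PΣ.∑[ m < suc b ] F m (b ∸ m)
  remove-β b = R.sym (begin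
      PΣ.∑[ m < suc b ] F m (b ∸ m)
    ≈⟨ PΣ.∑-cong< (suc b) (λ m m<1+b → R.trans
         (R.reflexive (cong (λ i → h m Y′ * (β ^ₚ (b ∸ m) * (cX * hℤ i X))) (reindex (ℕP.<⇒≤pred m<1+b))))
         (rotate (h m Y′) (β ^ₚ (b ∸ m)) cX q)) ⟩
      PΣ.∑[ m < suc b ] (cX * (q * (h m Y′ * β ^ₚ (b ∸ m))))
    ≈⟨ R.sym (PΣ.*-distribˡ-∑ cX (suc b) (λ m → q * (h m Y′ * β ^ₚ (b ∸ m)))) ⟩
      cX * PΣ.∑[ m < suc b ] (q * (h m Y′ * β ^ₚ (b ∸ m)))
    ≈⟨ *-congˡ cX (R.sym (PΣ.*-distribˡ-∑ q (suc b) (λ m → h m Y′ * β ^ₚ (b ∸ m)))) ⟩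
      cX * (q * (hSeq Y′ ⊛ powers β) b)
    ≈⟨ *-congˡ cX (*-congˡ q (R.sym (h-remove-letter Y β b))) ⟩
      cX * (q * h b Y)
    ∎)
    where
    q : PS
    q = hℤ (k +ℤ + b) X

Alphabet≥1-negA : ∀ {Z} → Alphabet≥1 Z → Alphabet≥1 (negA Z)
Alphabet≥1-negA = map⁺

Alphabet≥1-Aₖ : ∀ n → Alphabet≥1 (Aₖ n)
Alphabet≥1-Aₖ n = map⁺ (All.universal (λ t → Ord≥-neg (Ord≥-var (suc (3 ℕ.* t)))) (range 1 n))

Alphabet≥1-Bₖ : ∀ n → Alphabet≥1 (Bₖ n)
Alphabet≥1-Bₖ n = map⁺ (All.universal (λ t → Ord≥-var (suc (suc (3 ℕ.* t)))) (range 1 n))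

Alphabet≥1-A⟨]++B[] : ∀ a b i j → Alphabet≥1 (A⟨ a , b ] ++ B[ suc i , j ])
Alphabet≥1-A⟨]++B[] a b i j =
  ++⁺ (++⁺ (Alphabet≥1-Aₖ b) (Alphabet≥1-negA (Alphabet≥1-Aₖ a)))
      (++⁺ (Alphabet≥1-Bₖ j) (Alphabet≥1-negA (Alphabet≥1-Bₖ i)))

Bₖ-suc : ∀ t → Bₖ (suc t) ≡ Bₖ t ++ (pos , 𝛃 (suc t)) ∷ []
Bₖ-suc t = begin
    map βletter (map suc (upTo (suc t)))
  ≡⟨ cong (map βletter ∘ map suc) (sym (ListP.upTo-∷ʳ t)) ⟩
    map βletter (map suc (upTo t ++ t ∷ []))
  ≡⟨ cong (map βletter) (ListP.map-++ suc (upTo t) (t ∷ [])) ⟩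
    map βletter (map suc (upTo t) ++ suc t ∷ [])
  ≡⟨ ListP.map-++ βletter (map suc (upTo t)) (suc t ∷ []) ⟩
    Bₖ t ++ (pos , 𝛃 (suc t)) ∷ []
  ∎
  where
  open Eq.≡-Reasoning
  βletter : ℕ → Sign × PS
  βletter t = pos , 𝛃 t

B⟨⟩≡B[]-β : ∀ A t j → A ++ B⟨ suc t , j ] ≡ (A ++ B[ suc t , j ]) ++ (neg , 𝛃 (suc t)) ∷ []
B⟨⟩≡B[]-β A t j = begin
    A ++ (Bₖ j ++ negA (Bₖ (suc t)))
  ≡⟨ cong (λ W → A ++ (Bₖ j ++ negA W)) (Bₖ-suc t) ⟩
    A ++ (Bₖ j ++ negA (Bₖ t ++ (pos , 𝛃 (suc t)) ∷ []))
  ≡⟨ cong (λ W → A ++ (Bₖ j ++ W)) (ListP.map-++ _ (Bₖ t) ((pos , 𝛃 (suc t)) ∷ [])) ⟩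
    A ++ (Bₖ j ++ (negA (Bₖ t) ++ (neg , 𝛃 (suc t)) ∷ []))
  ≡⟨ cong (A ++_) (sym (ListP.++-assoc (Bₖ j) (negA (Bₖ t)) _)) ⟩
    A ++ ((Bₖ j ++ negA (Bₖ t)) ++ (neg , 𝛃 (suc t)) ∷ [])
  ≡⟨ sym (ListP.++-assoc A (Bₖ j ++ negA (Bₖ t)) _) ⟩
    (A ++ (Bₖ j ++ negA (Bₖ t))) ++ (neg , 𝛃 (suc t)) ∷ []
  ∎
  where open Eq.≡-Reasoning

proposition5p2 : (ℓ : ℕ) (la mu s : Fin ℓ → ℕ)
    → IsPartition la → IsPartition mu
    → (∀ (i : Fin ℓ) → 1 ≤ s i)
    → (∀ (i j : Fin ℓ) → toℕ j ≡ suc (toℕ i) → mu i < la j → s i ≤ s j)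
    → Grow ℓ la mu s ≈ₚ RHS ℓ la mu s
proposition5p2 ℓ la mu s _ _ _ _ = begin
    Grow ℓ la mu s
  ≈⟨ R.sym (det-scaleRows ℓ c M) ⟩
    det (λ i j → c i * M i j)
  ≈⟨ det-cong ℓ entry ⟩
    RHS ℓ la mu s
  ∎
  where
  open import Relation.Binary.Reasoning.Setoid R.setoid
  c : Fin ℓ → PS
  c i = prodₚ (map (flagFactor (𝛃 (ix i))) (range 1 (s i)))
  M : Fin ℓ → Fin ℓ → PS
  M i j = h⊖ (shift (la i) (mu j) (ix i) (ix j)) (xA 1 (s i)) (A⟨ mu j , la i ] ++ B[ ix i , ix j ])
  entry : ∀ i j → c i * M i j ≈ Σ∞ (λ m → h m (A⟨ mu j , la i ] ++ B⟨ ix i , ix j ])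
                                          * 𝔊 (s i) 1 (shift (la i) (mu j) (ix i) (ix j) +ℤ + m) (𝛃 (ix i)))
  entry i j = R.trans
    (h⊖-flagExpansion (shift (la i) (mu j) (ix i) (ix j)) (s i) (A⟨ mu j , la i ] ++ B[ ix i , ix j ]) (𝛃 (ix i))
      (Alphabet≥1-A⟨]++B[] (mu j) (la i) (toℕ i) (ix j)) (Ord≥-var _))
    (Σ∞-cong (λ m → *-congʳ (𝔊 (s i) 1 (shift (la i) (mu j) (ix i) (ix j) +ℤ + m) (𝛃 (ix i)))
                              (R.reflexive (cong (h m) (sym (B⟨⟩≡B[]-β (A⟨ mu j , la i ]) (toℕ i) (ix j)))))))
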